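{- Let $(H,\cdot,1,\Delta,\varepsilon,\rhd)$ be a right Post-Hopf algebra which is connected as a coalgebra. Then for every $n\in\mathbb{N}$, $H^{\le n}\rhd H\subseteq H^{\le n}$.
   Context: Sweedler notation $\Delta(x)=x^{(1)}\otimes x^{(2)}$. A right Post-Hopf algebra is a Hopf algebra $(H,\cdot,1,\Delta,\varepsilon)$ with a coalgebra morphism $\rhd:H\otimes H\to H$ such that for all $x,y,z$: $(x\cdot y)\rhd z=(x\rhd z^{(1)})\cdot(y\rhd z^{(2)})$, $(x\rhd y)\rhd z=x\rhd((y\rhd z^{(1)})\cdot z^{(2)})$, and $\gamma(x)(y)=y\rhd x$ defines an element of $\mathrm{Hom}(H,\mathrm{Hom}(H))$ invertible for the convolution product $(f\star g)(x)=f(x^{(1)})\circ g(x^{(2)})$. Let $\tilde\Delta(x)=\Delta(x)-1\otimes x-x\otimes 1$ for $x\in\ker\varepsilon$, $\tilde\Delta(1)=0$, $\tilde\Delta^{(0)}(x)=x-\varepsilon(x)1$, $\tilde\Delta^{(1)}=\tilde\Delta$, $\tilde\Delta^{(k)}=(\tilde\Delta\otimes\mathrm{Id}^{\otimes k-1})\circ\tilde\Delta^{(k-1)}$. $H$ is connected as a coalgebra if every $x$ has some $n$ with $\tilde\Delta^{(n)}(x)=0$; its coradical filtration is $H^{\le n}=\{x\in H:\tilde\Delta^{(n)}(x)=0\}$. -}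

module Defs where

open import Level using (Level; _⊔_; suc)
open import Data.Nat using (ℕ; zero) renaming (suc to sucℕ)
open import Data.Fin using (Fin)
open import Data.Product using (_×_; _,_; ∃; ∃-syntax)
open import Data.List using (List; []; _∷_; _++_; map; foldr; cartesianProductWith)
open import Data.Vec using (Vec; []; _∷_; _[_]≔_)
open import Relation.Nullary using (¬_)
open import Algebra.Bundles using (CommutativeRing)
open import Algebra.Module.Bundles using (Module)

IsField : ∀ {c ℓ} → CommutativeRing c ℓ → Set (c ⊔ ℓ)
IsField R = (¬ (1# ≈ 0#)) × (∀ a → ¬ (a ≈ 0#) → ∃[ b ] (a * b ≈ 1#))
  where open CommutativeRing R

module _ {c ℓ m ℓm} (R : CommutativeRing c ℓ) (M : Module R m ℓm) where
  open CommutativeRing R renaming (Carrier to K; _+_ to _+ₖ_; _*_ to _*ₖ_; _≈_ to _≈ₖ_; -_ to -ₖ_)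
  open Module M renaming (Carrierᴹ to H)

  -- H^{⊗ n}: formal k-linear combinations of words of length n,
  -- modulo the congruence generated by the relations defining the tensor product.
  Tensor : ℕ → Set (c ⊔ m)
  Tensor n = List (K × Vec H n)

  infix 4 _≈T_
  data _≈T_ {n : ℕ} : Tensor n → Tensor n → Set (c ⊔ ℓ ⊔ m ⊔ ℓm) where
    ≈T-refl  : ∀ {s} → s ≈T s
    ≈T-sym   : ∀ {s t} → s ≈T t → t ≈T s
    ≈T-trans : ∀ {s t u} → s ≈T t → t ≈T u → s ≈T u
    ≈T-++    : ∀ {s s′ t t′} → s ≈T s′ → t ≈T t′ → (s ++ t) ≈T (s′ ++ t′)
    ≈T-swap  : ∀ {s t} → (s ++ t) ≈T (t ++ s)
    coeff-cong : ∀ {a b v} → a ≈ₖ b → ((a , v) ∷ []) ≈T ((b , v) ∷ [])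
    coeff-+    : ∀ {a b v} → ((a +ₖ b , v) ∷ []) ≈T ((a , v) ∷ (b , v) ∷ [])
    coeff-0    : ∀ {v} → ((0# , v) ∷ []) ≈T []
    slot-cong  : ∀ {a v x y} (i : Fin n) → x ≈ᴹ y →
                 ((a , v [ i ]≔ x) ∷ []) ≈T ((a , v [ i ]≔ y) ∷ [])
    slot-+     : ∀ {a v x y} (i : Fin n) →
                 ((a , v [ i ]≔ (x +ᴹ y)) ∷ []) ≈T ((a , v [ i ]≔ x) ∷ (a , v [ i ]≔ y) ∷ [])
    slot-*     : ∀ {a b v x} (i : Fin n) →
                 ((a , v [ i ]≔ (b *ₗ x)) ∷ []) ≈T ((a *ₖ b , v [ i ]≔ x) ∷ [])

  scaleT : ∀ {n} → K → Tensor n → Tensor n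
  scaleT a = map (λ { (b , v) → (a *ₖ b , v) })

  _⊗_ : H → H → Tensor 2
  x ⊗ y = (1# , x ∷ y ∷ []) ∷ []

  liftFirst : ∀ {n} → (H → Tensor 2) → Tensor (sucℕ n) → Tensor (sucℕ (sucℕ n))
  liftFirst f [] = []
  liftFirst f ((a , x ∷ v) ∷ t) =
    map (λ { (b , (y ∷ z ∷ [])) → (a *ₖ b , y ∷ z ∷ v) }) (f x) ++ liftFirst f t

  liftSecond : (H → Tensor 2) → Tensor 2 → Tensor 3
  liftSecond f [] = []
  liftSecond f ((a , x ∷ y ∷ []) ∷ t) =
    map (λ { (b , (u ∷ w ∷ [])) → (a *ₖ b , x ∷ u ∷ w ∷ []) }) (f y) ++ liftSecond f t

  contract : (H → H → H) → Tensor 2 → H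
  contract f = foldr (λ { (a , (x ∷ y ∷ [])) acc → (a *ₗ f x y) +ᴹ acc }) 0ᴹ

  pairwise : (H → H → H) → Tensor 2 → Tensor 2 → Tensor 2
  pairwise op = cartesianProductWith
    (λ { (a , (x₁ ∷ x₂ ∷ [])) (b , (y₁ ∷ y₂ ∷ [])) → (a *ₖ b , op x₁ y₁ ∷ op x₂ y₂ ∷ []) })

  record IsLinearEnd (f : H → H) : Set (c ⊔ m ⊔ ℓm) where
    field
      cong   : ∀ {x y} → x ≈ᴹ y → f x ≈ᴹ f y
      additive : ∀ x y → f (x +ᴹ y) ≈ᴹ (f x +ᴹ f y)
      homogeneous : ∀ a x → f (a *ₗ x) ≈ᴹ (a *ₗ f x)

  record IsBilinear (f : H → H → H) : Set (c ⊔ m ⊔ ℓm) where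
    field
      linearˡ : ∀ y → IsLinearEnd (λ x → f x y)
      linearʳ : ∀ x → IsLinearEnd (λ y → f x y)

  record RightPostHopf : Set (suc (c ⊔ ℓ ⊔ m ⊔ ℓm)) where
    infixl 7 _·_
    infixl 6 _▷_
    field
      _·_   : H → H → H
      1H    : H
      ·-bilinear : IsBilinear _·_
      ·-assoc    : ∀ x y z → ((x · y) · z) ≈ᴹ (x · (y · z))
      ·-identityˡ : ∀ x → (1H · x) ≈ᴹ x
      ·-identityʳ : ∀ x → (x · 1H) ≈ᴹ x
      Δ : H → Tensor 2
      ε : H → K
      Δ-cong : ∀ {x y} → x ≈ᴹ y → Δ x ≈T Δ y
      Δ-additive : ∀ x y → Δ (x +ᴹ y) ≈T (Δ x ++ Δ y)
      Δ-homogeneous : ∀ a x → Δ (a *ₗ x) ≈T scaleT a (Δ x)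
      ε-cong : ∀ {x y} → x ≈ᴹ y → ε x ≈ₖ ε y
      ε-additive : ∀ x y → ε (x +ᴹ y) ≈ₖ (ε x +ₖ ε y)
      ε-homogeneous : ∀ a x → ε (a *ₗ x) ≈ₖ (a *ₖ ε x)
      Δ-coassoc : ∀ x → liftFirst Δ (Δ x) ≈T liftSecond Δ (Δ x)
      ε-counitˡ : ∀ x → contract (λ x₁ x₂ → ε x₁ *ₗ x₂) (Δ x) ≈ᴹ x
      ε-counitʳ : ∀ x → contract (λ x₁ x₂ → ε x₂ *ₗ x₁) (Δ x) ≈ᴹ x
      Δ-mult : ∀ x y → Δ (x · y) ≈T pairwise _·_ (Δ x) (Δ y)
      Δ-unit : Δ 1H ≈T (1H ⊗ 1H)
      ε-mult : ∀ x y → ε (x · y) ≈ₖ (ε x *ₖ ε y)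
      ε-unit : ε 1H ≈ₖ 1#
      S : H → H
      S-linear : IsLinearEnd S
      S-antipodeˡ : ∀ x → contract (λ x₁ x₂ → S x₁ · x₂) (Δ x) ≈ᴹ (ε x *ₗ 1H)
      S-antipodeʳ : ∀ x → contract (λ x₁ x₂ → x₁ · S x₂) (Δ x) ≈ᴹ (ε x *ₗ 1H)
      _▷_ : H → H → H
      ▷-bilinear : IsBilinear _▷_
      ▷-Δ : ∀ x y → Δ (x ▷ y) ≈T pairwise _▷_ (Δ x) (Δ y)
      ▷-ε : ∀ x y → ε (x ▷ y) ≈ₖ (ε x *ₖ ε y)
      ·-▷ : ∀ x y z → ((x · y) ▷ z) ≈ᴹ contract (λ z₁ z₂ → (x ▷ z₁) · (y ▷ z₂)) (Δ z)
      ▷-▷ : ∀ x y z → ((x ▷ y) ▷ z) ≈ᴹ contract (λ z₁ z₂ → x ▷ ((y ▷ z₁) · z₂)) (Δ z)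
      -- γ(x)(y) = y ▷ x is convolution-invertible in Hom(H, End(H)):
      -- there is a linear β : H → End(H) with γ ⋆ β = β ⋆ γ = (x ↦ ε(x) Id)
      β : H → H → H
      β-bilinear : IsBilinear β
      γ⋆β : ∀ x y → contract (λ x₁ x₂ → (β x₂ y) ▷ x₁) (Δ x) ≈ᴹ (ε x *ₗ y)
      β⋆γ : ∀ x y → contract (λ x₁ x₂ → β x₁ (y ▷ x₂)) (Δ x) ≈ᴹ (ε x *ₗ y)

  module _ (P : RightPostHopf) where
    open RightPostHopf P

    proj : H → H
    proj x = x +ᴹ (-ᴹ (ε x *ₗ 1H))

    -- reduced coproduct, extended linearly from ker ε with Δ̃(1) = 0
    Δ̃ : H → Tensor 2
    Δ̃ x = Δ (proj x) ++ ((-ₖ 1# , 1H ∷ proj x ∷ []) ∷ (-ₖ 1# , proj x ∷ 1H ∷ []) ∷ [])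

    Δ̃^ : (k : ℕ) → H → Tensor (sucℕ k)
    Δ̃^ zero x = (1# , proj x ∷ []) ∷ []
    Δ̃^ (sucℕ k) x = liftFirst Δ̃ (Δ̃^ k x)

    Filt : ℕ → H → Set (c ⊔ ℓ ⊔ m ⊔ ℓm)
    Filt n x = Δ̃^ n x ≈T []

    Connected : Set (c ⊔ ℓ ⊔ m ⊔ ℓm)
    Connected = ∀ x → ∃[ n ] Filt n x

{-# OPTIONS --safe #-}
-- For fixed y, x ↦ x ▷ y intertwines the iterated reduced coproduct with the iterated
-- coproduct of y: Δ̃⁽ᵏ⁾(x ▷ y) = Δ̃⁽ᵏ⁾(x) ▷ Δ⁽ᵏ⁾(y), where ▷ acts slotwise on tensors.
-- Hence Δ̃⁽ⁿ⁾(x) = 0 forces Δ̃⁽ⁿ⁾(x ▷ y) = 0. The identity follows by induction on k from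
-- Δ(x ▷ y) = Δx ▷ Δy, once the unit corrections of Δ̃ are seen to pass through ▷. That rests
-- on 1 ▷ z = ε(z)1, obtained from γ ⋆ β = ε, the axiom (x·y) ▷ z = (x ▷ z₁)(y ▷ z₂) at x = 1,
-- and coassociativity.
module Submission where

open import Level using (_⊔_)
open import Data.Nat using (ℕ; zero; suc; _+_)
open import Data.Fin using (Fin; zero; suc; _↑ˡ_)
open import Data.Product using (_×_; _,_)
open import Data.List using ([]; _∷_; _++_; map)
open import Data.List.Properties
  using (map-++; map-cong; ++-assoc; ++-identityʳ; cartesianProductWith-distribʳ-++)
open import Data.Vec using (Vec; []; _∷_; _[_]≔_; zipWith; lookup)
import Data.Vec as Vec
open import Data.Vec.Properties using ([]≔-++-↑ˡ)
open import Relation.Binary.Bundles using (Setoid)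
open import Relation.Binary.PropositionalEquality as ≡ using (_≡_)
import Relation.Binary.Reasoning.Setoid as SetoidReasoning
open import Algebra.Bundles using (CommutativeRing; CommutativeMonoid)
open import Algebra.Module.Bundles using (Module)
import Algebra.Properties.CommutativeSemigroup as CommutativeSemigroupProperties
import Algebra.Properties.Group as GroupProperties
import Algebra.Properties.AbelianGroup as AbelianGroupProperties
open import Defs

zipWith-[]≔ : ∀ {a b c} {A : Set a} {B : Set b} {C : Set c} {n} (f : A → B → C)
              (v : Vec A n) (w : Vec B n) i x →
              zipWith f (v [ i ]≔ x) w ≡ zipWith f v w [ i ]≔ f x (lookup w i)
zipWith-[]≔ f (x₀ ∷ v) (y ∷ w) zero    x = ≡.refl
zipWith-[]≔ f (x₀ ∷ v) (y ∷ w) (suc i) x = ≡.cong (f x₀ y ∷_) (zipWith-[]≔ f v w i x)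

module Tensors {c ℓ m ℓm} (R : CommutativeRing c ℓ) (M : Module R m ℓm) where
  open CommutativeRing R hiding (zero)
    renaming (Carrier to K; _+_ to _+ₖ_; _*_ to _*ₖ_)
  open Module M renaming (Carrierᴹ to H)
  open CommutativeSemigroupProperties *-commutativeSemigroup using (x∙yz≈y∙xz)
  open GroupProperties +ᴹ-group using (inverseʳ-unique)

  module Linear = IsLinearEnd

  H^⊗ : ℕ → Set (c ⊔ m)
  H^⊗ = Tensor R M

  infix 4 _≋_
  _≋_ : ∀ {n} → H^⊗ n → H^⊗ n → Set (c ⊔ ℓ ⊔ m ⊔ ℓm)
  _≋_ = _≈T_ R M

  ≋-setoid : ℕ → Setoid (c ⊔ m) (c ⊔ ℓ ⊔ m ⊔ ℓm)
  ≋-setoid n = record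
    { Carrier       = H^⊗ n
    ; _≈_           = _≋_
    ; isEquivalence = record { refl = ≈T-refl ; sym = ≈T-sym ; trans = ≈T-trans }
    }

  module ≋-Reasoning {n} = SetoidReasoning (≋-setoid n)

  ≡⇒≋ : ∀ {n} {s t : H^⊗ n} → s ≡ t → s ≋ t
  ≡⇒≋ ≡.refl = ≈T-refl

  ∷-cong : ∀ {n} {e f : K × Vec H n} {s t : H^⊗ n} → (e ∷ []) ≋ (f ∷ []) → s ≋ t → (e ∷ s) ≋ (f ∷ t)
  ∷-cong = ≈T-++

  ++-congˡ : ∀ {n} {s s′ t : H^⊗ n} → s ≋ s′ → (s ++ t) ≋ (s′ ++ t)
  ++-congˡ p = ≈T-++ p ≈T-refl

  ++-congʳ : ∀ {n} {s t t′ : H^⊗ n} → t ≋ t′ → (s ++ t) ≋ (s ++ t′)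
  ++-congʳ = ≈T-++ ≈T-refl

  ++-interchange : ∀ {n} (s t u w : H^⊗ n) → ((s ++ t) ++ (u ++ w)) ≋ ((s ++ u) ++ (t ++ w))
  ++-interchange s t u w = begin
    (s ++ t) ++ (u ++ w)  ≡⟨ ++-assoc s t (u ++ w) ⟩
    s ++ (t ++ (u ++ w))  ≡⟨ ≡.cong (s ++_) (≡.sym (++-assoc t u w)) ⟩
    s ++ ((t ++ u) ++ w)  ≈⟨ ++-congʳ {s = s} (++-congˡ {t = w} (≈T-swap {s = t} {t = u})) ⟩
    s ++ ((u ++ t) ++ w)  ≡⟨ ≡.cong (s ++_) (++-assoc u t w) ⟩
    s ++ (u ++ (t ++ w))  ≡⟨ ≡.sym (++-assoc s u (t ++ w)) ⟩
    (s ++ u) ++ (t ++ w)  ∎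
    where open ≋-Reasoning

  module _ {a} {A : Set a} {n : ℕ} where

    map-cong-≋ : {g h : A → K × Vec H n} → (∀ e → (g e ∷ []) ≋ (h e ∷ [])) →
                 ∀ es → map g es ≋ map h es
    map-cong-≋ p []       = ≈T-refl
    map-cong-≋ p (e ∷ es) = ∷-cong (p e) (map-cong-≋ p es)

    map-∘-cong-≋ : ∀ {b} {B : Set b} {g : A → K × Vec H n} {h : B → K × Vec H n} {k : A → B} →
                   (∀ e → (g e ∷ []) ≋ (h (k e) ∷ [])) → ∀ es → map g es ≋ map h (map k es)
    map-∘-cong-≋ p []       = ≈T-refl
    map-∘-cong-≋ p (e ∷ es) = ∷-cong (p e) (map-∘-cong-≋ p es)

    map-split-≋ : {g g₁ g₂ : A → K × Vec H n} → (∀ e → (g e ∷ []) ≋ (g₁ e ∷ g₂ e ∷ [])) →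
                  ∀ es → map g es ≋ (map g₁ es ++ map g₂ es)
    map-split-≋ p []       = ≈T-refl
    map-split-≋ {g₁ = g₁} {g₂} p (e ∷ es) =
      ≈T-trans (≈T-++ (p e) (map-split-≋ p es))
               (++-interchange (g₁ e ∷ []) (g₂ e ∷ []) (map g₁ es) (map g₂ es))

    map-vanish : {g : A → K × Vec H n} → (∀ e → (g e ∷ []) ≋ []) → ∀ es → map g es ≋ []
    map-vanish p []       = ≈T-refl
    map-vanish p (e ∷ es) = ≈T-++ {s′ = []} (p e) (map-vanish p es)

  module _ {n k} (φ : Vec H n → Vec H k) (ι : Fin n → Fin k)
           (φ-[]≔ : ∀ v i x → φ (v [ i ]≔ x) ≡ φ v [ ι i ]≔ x) (a : K) where

    relabel : K × Vec H n → K × Vec H k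
    relabel (b , v) = (a *ₖ b , φ v)

    map-relabel-cong : ∀ {s t} → s ≋ t → map relabel s ≋ map relabel t
    map-relabel-cong ≈T-refl        = ≈T-refl
    map-relabel-cong (≈T-sym p)     = ≈T-sym (map-relabel-cong p)
    map-relabel-cong (≈T-trans p q) = ≈T-trans (map-relabel-cong p) (map-relabel-cong q)
    map-relabel-cong (≈T-++ {s} {s′} {t} {t′} p q) =
      ≡.subst₂ _≋_ (≡.sym (map-++ relabel s t)) (≡.sym (map-++ relabel s′ t′))
        (≈T-++ (map-relabel-cong p) (map-relabel-cong q))
    map-relabel-cong (≈T-swap {s} {t}) =
      ≡.subst₂ _≋_ (≡.sym (map-++ relabel s t)) (≡.sym (map-++ relabel t s))
        (≈T-swap {s = map relabel s})
    map-relabel-cong (coeff-cong p) = coeff-cong (*-cong refl p)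
    map-relabel-cong coeff-+        = ≈T-trans (coeff-cong (distribˡ _ _ _)) coeff-+
    map-relabel-cong coeff-0        = ≈T-trans (coeff-cong (zeroʳ _)) coeff-0
    map-relabel-cong (slot-cong {v = v} {x} {y} i p)
      rewrite φ-[]≔ v i x | φ-[]≔ v i y = slot-cong (ι i) p
    map-relabel-cong (slot-+ {v = v} {x} {y} i)
      rewrite φ-[]≔ v i (x +ᴹ y) | φ-[]≔ v i x | φ-[]≔ v i y = slot-+ (ι i)
    map-relabel-cong (slot-* {b = b} {v = v} {x = x} i)
      rewrite φ-[]≔ v i (b *ₗ x) | φ-[]≔ v i x =
      ≈T-trans (slot-* (ι i)) (coeff-cong (*-assoc _ _ _))

  scaleT-cong : ∀ {n} (a : K) {s t : H^⊗ n} → s ≋ t → scaleT R M a s ≋ scaleT R M a t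
  scaleT-cong a = map-relabel-cong (λ v → v) (λ i → i) (λ _ _ _ → ≡.refl) a

  scaleT-assoc : ∀ {n} a b (s : H^⊗ n) → scaleT R M a (scaleT R M b s) ≋ scaleT R M (a *ₖ b) s
  scaleT-assoc a b []            = ≈T-refl
  scaleT-assoc a b ((d , v) ∷ s) = ∷-cong (coeff-cong (sym (*-assoc a b d))) (scaleT-assoc a b s)

  append : ∀ {n k} → K → Vec H k → K × Vec H n → K × Vec H (n + k)
  append a w (b , v) = (a *ₖ b , v Vec.++ w)

  map-append-cong : ∀ {n k} (a : K) (w : Vec H k) {s t : H^⊗ n} →
                    s ≋ t → map (append a w) s ≋ map (append a w) t
  map-append-cong {k = k} a w = map-relabel-cong (Vec._++ w) (_↑ˡ k) (λ v i x → ≡.sym ([]≔-++-↑ˡ v w i)) a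

  map-append-scaleT : ∀ {n k} a b (w : Vec H k) (s : H^⊗ n) →
                      map (append a w) (scaleT R M b s) ≋ scaleT R M b (map (append a w) s)
  map-append-scaleT a b w []            = ≈T-refl
  map-append-scaleT a b w ((d , v) ∷ s) = ∷-cong (coeff-cong (x∙yz≈y∙xz a b d)) (map-append-scaleT a b w s)

  prefix : ∀ {n} → K → H → K × Vec H n → K × Vec H (suc n)
  prefix a x (b , v) = (a *ₖ b , x ∷ v)

  liftFirst-∷ : ∀ {n} (f : H → H^⊗ 2) a x (v : Vec H n) t →
                liftFirst R M f ((a , x ∷ v) ∷ t) ≡ map (append a v) (f x) ++ liftFirst R M f t
  liftFirst-∷ f a x v t = ≡.cong (_++ liftFirst R M f t) (map-cong (λ { (b , y ∷ z ∷ []) → ≡.refl }) (f x))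

  liftFirst-++ : ∀ {n} (f : H → H^⊗ 2) (s t : H^⊗ (suc n)) →
                 liftFirst R M f (s ++ t) ≡ liftFirst R M f s ++ liftFirst R M f t
  liftFirst-++ f []                 t = ≡.refl
  liftFirst-++ f ((a , x ∷ v) ∷ s) t =
    ≡.trans (≡.cong (map _ (f x) ++_) (liftFirst-++ f s t)) (≡.sym (++-assoc (map _ (f x)) _ _))

  liftSecond-∷ : ∀ (f : H → H^⊗ 2) a x y t →
                 liftSecond R M f ((a , x ∷ y ∷ []) ∷ t) ≡ map (prefix a x) (f y) ++ liftSecond R M f t
  liftSecond-∷ f a x y t = ≡.cong (_++ liftSecond R M f t) (map-cong (λ { (b , u ∷ w ∷ []) → ≡.refl }) (f y))

  record IsLinear⊗ {k} (f : H → H^⊗ k) : Set (c ⊔ ℓ ⊔ m ⊔ ℓm) where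
    field
      cong        : ∀ {x y} → x ≈ᴹ y → f x ≋ f y
      additive    : ∀ x y → f (x +ᴹ y) ≋ (f x ++ f y)
      homogeneous : ∀ b x → f (b *ₗ x) ≋ scaleT R M b (f x)

  IsMultilinear⊗ : ∀ {n k} → (Vec H n → H^⊗ k) → Set (c ⊔ ℓ ⊔ m ⊔ ℓm)
  IsMultilinear⊗ F = ∀ v i → IsLinear⊗ (λ x → F (v [ i ]≔ x))

  IsLinear⊗-∘ : ∀ {k} {f : H → H^⊗ k} {g : H → H} →
                IsLinear⊗ f → IsLinearEnd R M g → IsLinear⊗ (λ x → f (g x))
  IsLinear⊗-∘ {g = g} f-lin g-lin = record
    { cong        = λ p → cong (Linear.cong g-lin p)
    ; additive    = λ x y → ≈T-trans (cong (Linear.additive g-lin x y)) (additive (g x) (g y))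
    ; homogeneous = λ b x → ≈T-trans (cong (Linear.homogeneous g-lin b x)) (homogeneous b (g x))
    }
    where open IsLinear⊗ f-lin

  IsLinear⊗-++ : ∀ {k} {f g : H → H^⊗ k} → IsLinear⊗ f → IsLinear⊗ g → IsLinear⊗ (λ x → f x ++ g x)
  IsLinear⊗-++ {f = f} {g} f-lin g-lin = record
    { cong        = λ p → ≈T-++ (F.cong p) (G.cong p)
    ; additive    = λ x y → ≈T-trans (≈T-++ (F.additive x y) (G.additive x y))
                                     (++-interchange (f x) (f y) (g x) (g y))
    ; homogeneous = λ b x → ≈T-trans (≈T-++ (F.homogeneous b x) (G.homogeneous b x))
                                     (≡⇒≋ (≡.sym (map-++ _ (f x) (g x))))
    }
    where module F = IsLinear⊗ f-lin
          module G = IsLinear⊗ g-lin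

  extend : ∀ {n k} → (Vec H n → H^⊗ k) → H^⊗ n → H^⊗ k
  extend F []            = []
  extend F ((a , v) ∷ t) = scaleT R M a (F v) ++ extend F t

  extend-++ : ∀ {n k} (F : Vec H n → H^⊗ k) s t → extend F (s ++ t) ≡ extend F s ++ extend F t
  extend-++ F []            t = ≡.refl
  extend-++ F ((a , v) ∷ s) t =
    ≡.trans (≡.cong (scaleT R M a (F v) ++_) (extend-++ F s t)) (≡.sym (++-assoc (scaleT R M a (F v)) _ _))

  extend-cong : ∀ {n k} {F : Vec H n → H^⊗ k} → IsMultilinear⊗ F →
                ∀ {s t} → s ≋ t → extend F s ≋ extend F t
  extend-cong F-lin ≈T-refl        = ≈T-refl
  extend-cong F-lin (≈T-sym p)     = ≈T-sym (extend-cong F-lin p)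
  extend-cong F-lin (≈T-trans p q) = ≈T-trans (extend-cong F-lin p) (extend-cong F-lin q)
  extend-cong {F = F} F-lin (≈T-++ {s} {s′} {t} {t′} p q) =
    ≡.subst₂ _≋_ (≡.sym (extend-++ F s t)) (≡.sym (extend-++ F s′ t′))
      (≈T-++ (extend-cong F-lin p) (extend-cong F-lin q))
  extend-cong {F = F} F-lin (≈T-swap {s} {t}) =
    ≡.subst₂ _≋_ (≡.sym (extend-++ F s t)) (≡.sym (extend-++ F t s)) (≈T-swap {s = extend F s})
  extend-cong {F = F} F-lin (coeff-cong {v = v} p) =
    ++-congˡ (map-cong-≋ (λ { (b , u) → coeff-cong (*-cong p refl) }) (F v))
  extend-cong {F = F} F-lin (coeff-+ {a} {v = v}) =
    ≈T-trans (++-congˡ (map-split-≋ (λ { (d , u) → ≈T-trans (coeff-cong (distribʳ _ _ _)) coeff-+ }) (F v)))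
             (≡⇒≋ (++-assoc (scaleT R M a (F v)) _ []))
  extend-cong {F = F} F-lin (coeff-0 {v}) =
    ++-congˡ {t = []} (map-vanish (λ { (b , u) → ≈T-trans (coeff-cong (zeroˡ _)) coeff-0 }) (F v))
  extend-cong F-lin (slot-cong {a} {v} i p) = ++-congˡ (scaleT-cong a (IsLinear⊗.cong (F-lin v i) p))
  extend-cong {F = F} F-lin (slot-+ {a} {v} {x} {y} i) =
    ≈T-trans (++-congˡ (≈T-trans (scaleT-cong a (IsLinear⊗.additive (F-lin v i) x y))
                                 (≡⇒≋ (map-++ _ (F (v [ i ]≔ x)) _))))
             (≡⇒≋ (++-assoc (scaleT R M a (F (v [ i ]≔ x))) _ []))
  extend-cong {F = F} F-lin (slot-* {a} {b} {v} {x} i) =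
    ++-congˡ (≈T-trans (scaleT-cong a (IsLinear⊗.homogeneous (F-lin v i) b x))
                       (scaleT-assoc a b (F (v [ i ]≔ x))))

  -- liftFirst f is the multilinear extension of x ∷ w ↦ f x ⊗ w, so it inherits extend-cong.
  module _ {f : H → H^⊗ 2} (f-lin : IsLinear⊗ f) where
    open IsLinear⊗ f-lin

    applyHead : ∀ {n} → Vec H (suc n) → H^⊗ (suc (suc n))
    applyHead (x ∷ w) = map (append 1# w) (f x)

    applyHead-multilinear : ∀ {n} → IsMultilinear⊗ (applyHead {n})
    applyHead-multilinear (x₀ ∷ w) zero = record
      { cong        = λ p → map-append-cong 1# w (cong p)
      ; additive    = λ x y → ≈T-trans (map-append-cong 1# w (additive x y)) (≡⇒≋ (map-++ _ (f x) (f y)))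
      ; homogeneous = λ b x → ≈T-trans (map-append-cong 1# w (homogeneous b x))
                                       (map-append-scaleT 1# b w (f x))
      }
    applyHead-multilinear (x₀ ∷ w) (suc j) = record
      { cong        = λ p → map-cong-≋ (λ { (b , y ∷ z ∷ []) →
          slot-cong {v = y ∷ z ∷ w} (suc (suc j)) p }) (f x₀)
      ; additive    = λ x y → map-split-≋ (λ { (b , y ∷ z ∷ []) →
          slot-+ {v = y ∷ z ∷ w} (suc (suc j)) }) (f x₀)
      ; homogeneous = λ b x → map-∘-cong-≋ (λ { (d , y ∷ z ∷ []) →
          ≈T-trans (slot-* {v = y ∷ z ∷ w} (suc (suc j))) (coeff-cong (*-comm _ _)) }) (f x₀)
      }

    liftFirst≋extend : ∀ {n} (t : H^⊗ (suc n)) → liftFirst R M f t ≋ extend applyHead t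
    liftFirst≋extend []                 = ≈T-refl
    liftFirst≋extend ((a , x ∷ v) ∷ t) =
      ≈T-trans (≡⇒≋ (liftFirst-∷ f a x v t))
        (≈T-++ (map-∘-cong-≋ (λ { (d , u) → coeff-cong (*-cong refl (sym (*-identityˡ d))) }) (f x))
               (liftFirst≋extend t))

    liftFirst-cong : ∀ {n} {s t : H^⊗ (suc n)} → s ≋ t → liftFirst R M f s ≋ liftFirst R M f t
    liftFirst-cong {s = s} {t} p =
      ≈T-trans (liftFirst≋extend s)
        (≈T-trans (extend-cong applyHead-multilinear p) (≈T-sym (liftFirst≋extend t)))

  linear-0 : ∀ {f} → IsLinearEnd R M f → f 0ᴹ ≈ᴹ 0ᴹ
  linear-0 {f} f-lin = begin
    f 0ᴹ            ≈⟨ Linear.cong f-lin (≈ᴹ-sym (*ₗ-zeroˡ 0ᴹ)) ⟩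
    f (0# *ₗ 0ᴹ)    ≈⟨ Linear.homogeneous f-lin 0# 0ᴹ ⟩
    0# *ₗ f 0ᴹ      ≈⟨ *ₗ-zeroˡ _ ⟩
    0ᴹ              ∎
    where open SetoidReasoning ≈ᴹ-setoid

  linear-neg : ∀ {f} → IsLinearEnd R M f → ∀ x → f (-ᴹ x) ≈ᴹ -ᴹ f x
  linear-neg {f} f-lin x = inverseʳ-unique (f x) (f (-ᴹ x)) (begin
    f x +ᴹ f (-ᴹ x)  ≈⟨ ≈ᴹ-sym (Linear.additive f-lin x (-ᴹ x)) ⟩
    f (x +ᴹ -ᴹ x)    ≈⟨ Linear.cong f-lin (-ᴹ‿inverseʳ x) ⟩
    f 0ᴹ             ≈⟨ linear-0 f-lin ⟩
    0ᴹ               ∎)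
    where open SetoidReasoning ≈ᴹ-setoid

  linear-∘ : ∀ {f g} → IsLinearEnd R M f → IsLinearEnd R M g → IsLinearEnd R M (λ x → f (g x))
  linear-∘ {f} {g} f-lin g-lin = record
    { cong        = λ p → Linear.cong f-lin (Linear.cong g-lin p)
    ; additive    = λ x y → ≈ᴹ-trans (Linear.cong f-lin (Linear.additive g-lin x y))
                                     (Linear.additive f-lin (g x) (g y))
    ; homogeneous = λ a x → ≈ᴹ-trans (Linear.cong f-lin (Linear.homogeneous g-lin a x))
                                     (Linear.homogeneous f-lin a (g x))
    }

  *ₗ-linear : ∀ b → IsLinearEnd R M (b *ₗ_)
  *ₗ-linear b = record
    { cong        = *ₗ-congˡ
    ; additive    = *ₗ-distribˡ b
    ; homogeneous = λ a x → ≈ᴹ-trans (≈ᴹ-sym (*ₗ-assoc b a x))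
                                     (≈ᴹ-trans (*ₗ-cong (*-comm b a) ≈ᴹ-refl) (*ₗ-assoc a b x))
    }

  IsMultilinearᴹ : ∀ {n} → (Vec H n → H) → Set (c ⊔ m ⊔ ℓm)
  IsMultilinearᴹ F = ∀ v i → IsLinearEnd R M (λ x → F (v [ i ]≔ x))

  extendᴹ : ∀ {n} → (Vec H n → H) → H^⊗ n → H
  extendᴹ F []            = 0ᴹ
  extendᴹ F ((a , v) ∷ t) = (a *ₗ F v) +ᴹ extendᴹ F t

  extendᴹ-++ : ∀ {n} (F : Vec H n → H) s t → extendᴹ F (s ++ t) ≈ᴹ extendᴹ F s +ᴹ extendᴹ F t
  extendᴹ-++ F []            t = ≈ᴹ-sym (+ᴹ-identityˡ _)
  extendᴹ-++ F ((a , v) ∷ s) t = ≈ᴹ-trans (+ᴹ-congˡ (extendᴹ-++ F s t)) (≈ᴹ-sym (+ᴹ-assoc _ _ _))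

  extendᴹ-cong : ∀ {n} {F : Vec H n → H} → IsMultilinearᴹ F → ∀ {s t} → s ≋ t → extendᴹ F s ≈ᴹ extendᴹ F t
  extendᴹ-cong F-lin ≈T-refl        = ≈ᴹ-refl
  extendᴹ-cong F-lin (≈T-sym p)     = ≈ᴹ-sym (extendᴹ-cong F-lin p)
  extendᴹ-cong F-lin (≈T-trans p q) = ≈ᴹ-trans (extendᴹ-cong F-lin p) (extendᴹ-cong F-lin q)
  extendᴹ-cong {F = F} F-lin (≈T-++ {s} {s′} {t} {t′} p q) =
    ≈ᴹ-trans (extendᴹ-++ F s t)
      (≈ᴹ-trans (+ᴹ-cong (extendᴹ-cong F-lin p) (extendᴹ-cong F-lin q)) (≈ᴹ-sym (extendᴹ-++ F s′ t′)))
  extendᴹ-cong {F = F} F-lin (≈T-swap {s} {t}) =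
    ≈ᴹ-trans (extendᴹ-++ F s t) (≈ᴹ-trans (+ᴹ-comm _ _) (≈ᴹ-sym (extendᴹ-++ F t s)))
  extendᴹ-cong F-lin (coeff-cong p) = +ᴹ-congʳ (*ₗ-cong p ≈ᴹ-refl)
  extendᴹ-cong F-lin coeff-+        = ≈ᴹ-trans (+ᴹ-congʳ (*ₗ-distribʳ _ _ _)) (+ᴹ-assoc _ _ _)
  extendᴹ-cong F-lin coeff-0        = ≈ᴹ-trans (+ᴹ-identityʳ _) (*ₗ-zeroˡ _)
  extendᴹ-cong F-lin (slot-cong {v = v} i p) = +ᴹ-congʳ (*ₗ-congˡ (Linear.cong (F-lin v i) p))
  extendᴹ-cong F-lin (slot-+ {a} {v} {x} {y} i) =
    ≈ᴹ-trans (+ᴹ-congʳ (≈ᴹ-trans (*ₗ-congˡ (Linear.additive (F-lin v i) x y)) (*ₗ-distribˡ a _ _)))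
             (+ᴹ-assoc _ _ _)
  extendᴹ-cong F-lin (slot-* {a} {b} {v} {x} i) =
    +ᴹ-congʳ (≈ᴹ-trans (*ₗ-congˡ (Linear.homogeneous (F-lin v i) b x)) (≈ᴹ-sym (*ₗ-assoc a b _)))

  extendᴹ-append : ∀ {n} (F : Vec H (suc (suc n)) → H) a (w : Vec H n) L →
                   extendᴹ F (map (append a w) L) ≈ᴹ a *ₗ contract R M (λ x y → F (x ∷ y ∷ w)) L
  extendᴹ-append F a w []                      = ≈ᴹ-sym (*ₗ-zeroʳ a)
  extendᴹ-append F a w ((b , x ∷ y ∷ []) ∷ L) =
    ≈ᴹ-trans (+ᴹ-cong (*ₗ-assoc a b _) (extendᴹ-append F a w L)) (≈ᴹ-sym (*ₗ-distribˡ a _ _))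

  extendᴹ-prefix : ∀ (F : Vec H 3 → H) a x L →
                   extendᴹ F (map (prefix a x) L) ≈ᴹ a *ₗ contract R M (λ y z → F (x ∷ y ∷ z ∷ [])) L
  extendᴹ-prefix F a x []                      = ≈ᴹ-sym (*ₗ-zeroʳ a)
  extendᴹ-prefix F a x ((b , y ∷ z ∷ []) ∷ L) =
    ≈ᴹ-trans (+ᴹ-cong (*ₗ-assoc a b _) (extendᴹ-prefix F a x L)) (≈ᴹ-sym (*ₗ-distribˡ a _ _))

  extendᴹ-liftFirst : ∀ (f : H → H^⊗ 2) (F : Vec H 3 → H) t →
    extendᴹ F (liftFirst R M f t) ≈ᴹ contract R M (λ u z → contract R M (λ x y → F (x ∷ y ∷ z ∷ [])) (f u)) t
  extendᴹ-liftFirst f F []                        = ≈ᴹ-refl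
  extendᴹ-liftFirst f F ((a , u ∷ z ∷ []) ∷ t) = begin
    extendᴹ F (liftFirst R M f ((a , u ∷ z ∷ []) ∷ t))
      ≡⟨ ≡.cong (extendᴹ F) (liftFirst-∷ f a u (z ∷ []) t) ⟩
    extendᴹ F (map (append a (z ∷ [])) (f u) ++ liftFirst R M f t)
      ≈⟨ extendᴹ-++ F (map (append a (z ∷ [])) (f u)) _ ⟩
    extendᴹ F (map (append a (z ∷ [])) (f u)) +ᴹ extendᴹ F (liftFirst R M f t)
      ≈⟨ +ᴹ-cong (extendᴹ-append F a (z ∷ []) (f u)) (extendᴹ-liftFirst f F t) ⟩
    contract R M (λ u z → contract R M (λ x y → F (x ∷ y ∷ z ∷ [])) (f u)) ((a , u ∷ z ∷ []) ∷ t) ∎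
    where open SetoidReasoning ≈ᴹ-setoid

  extendᴹ-liftSecond : ∀ (f : H → H^⊗ 2) (F : Vec H 3 → H) t →
    extendᴹ F (liftSecond R M f t) ≈ᴹ contract R M (λ x u → contract R M (λ y z → F (x ∷ y ∷ z ∷ [])) (f u)) t
  extendᴹ-liftSecond f F []                        = ≈ᴹ-refl
  extendᴹ-liftSecond f F ((a , x ∷ u ∷ []) ∷ t) = begin
    extendᴹ F (liftSecond R M f ((a , x ∷ u ∷ []) ∷ t))
      ≡⟨ ≡.cong (extendᴹ F) (liftSecond-∷ f a x u t) ⟩
    extendᴹ F (map (prefix a x) (f u) ++ liftSecond R M f t)
      ≈⟨ extendᴹ-++ F (map (prefix a x) (f u)) _ ⟩
    extendᴹ F (map (prefix a x) (f u)) +ᴹ extendᴹ F (liftSecond R M f t)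
      ≈⟨ +ᴹ-cong (extendᴹ-prefix F a x (f u)) (extendᴹ-liftSecond f F t) ⟩
    contract R M (λ x u → contract R M (λ y z → F (x ∷ y ∷ z ∷ [])) (f u)) ((a , x ∷ u ∷ []) ∷ t) ∎
    where open SetoidReasoning ≈ᴹ-setoid

  contract-cong : ∀ {f g : H → H → H} → (∀ x y → f x y ≈ᴹ g x y) →
                  ∀ L → contract R M f L ≈ᴹ contract R M g L
  contract-cong p []                      = ≈ᴹ-refl
  contract-cong p ((a , x ∷ y ∷ []) ∷ L) = +ᴹ-cong (*ₗ-congˡ (p x y)) (contract-cong p L)

  contract-linear : ∀ (f g : H → H → H) {h} → IsLinearEnd R M h → (∀ x y → f x y ≈ᴹ h (g x y)) →
                    ∀ L → contract R M f L ≈ᴹ h (contract R M g L)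
  contract-linear f g h-lin p []                      = ≈ᴹ-sym (linear-0 h-lin)
  contract-linear f g h-lin p ((a , x ∷ y ∷ []) ∷ L) =
    ≈ᴹ-trans (+ᴹ-cong (≈ᴹ-trans (*ₗ-congˡ (p x y)) (≈ᴹ-sym (Linear.homogeneous h-lin a (g x y))))
                      (contract-linear f g h-lin p L))
             (≈ᴹ-sym (Linear.additive h-lin _ _))

  intoSlot : ∀ {n} → K → Vec H n → Fin n → (H → H → H) → K × Vec H 2 → K × Vec H n
  intoSlot a v i g (b , x ∷ y ∷ []) = (a *ₖ b , v [ i ]≔ g x y)

  map-intoSlot : ∀ {n} a (v : Vec H n) i g L →
                 map (intoSlot a v i g) L ≋ ((a , v [ i ]≔ contract R M g L) ∷ [])
  map-intoSlot a v i g [] = ≈T-sym (begin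
    (a , v [ i ]≔ 0ᴹ) ∷ []           ≈⟨ slot-cong i (≈ᴹ-sym (*ₗ-zeroˡ 0ᴹ)) ⟩
    (a , v [ i ]≔ (0# *ₗ 0ᴹ)) ∷ []   ≈⟨ slot-* i ⟩
    (a *ₖ 0# , v [ i ]≔ 0ᴹ) ∷ []     ≈⟨ coeff-cong (zeroʳ a) ⟩
    (0# , v [ i ]≔ 0ᴹ) ∷ []          ≈⟨ coeff-0 ⟩
    []                               ∎)
    where open ≋-Reasoning
  map-intoSlot a v i g ((b , x ∷ y ∷ []) ∷ L) =
    ≈T-trans (∷-cong (≈T-sym (slot-* i)) (map-intoSlot a v i g L)) (≈T-sym (slot-+ i))

module PostHopf {c ℓ m ℓm} {R : CommutativeRing c ℓ} {M : Module R m ℓm} (P : RightPostHopf R M) where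
  open CommutativeRing R hiding (zero)
    renaming (Carrier to K; _+_ to _+ₖ_; _*_ to _*ₖ_; -_ to -ₖ_)
  open Module M renaming (Carrierᴹ to H)
  open RightPostHopf P
  open Tensors R M
  open CommutativeSemigroupProperties *-commutativeSemigroup using (interchange)
  open CommutativeSemigroupProperties (CommutativeMonoid.commutativeSemigroup +ᴹ-commutativeMonoid)
    using () renaming (interchange to +ᴹ-interchange)
  open AbelianGroupProperties +ᴹ-abelianGroup using (⁻¹-∙-comm)

  ▷-linearˡ : ∀ y → IsLinearEnd R M (_▷ y)
  ▷-linearˡ = IsBilinear.linearˡ ▷-bilinear

  ▷-linearʳ : ∀ x → IsLinearEnd R M (x ▷_)
  ▷-linearʳ = IsBilinear.linearʳ ▷-bilinear

  ·-linearˡ : ∀ y → IsLinearEnd R M (_· y)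
  ·-linearˡ = IsBilinear.linearˡ ·-bilinear

  ·-linearʳ : ∀ x → IsLinearEnd R M (x ·_)
  ·-linearʳ = IsBilinear.linearʳ ·-bilinear

  β-linearˡ : ∀ y → IsLinearEnd R M (λ x → β x y)
  β-linearˡ = IsBilinear.linearˡ β-bilinear

  Δ-linear : IsLinear⊗ Δ
  Δ-linear = record { cong = Δ-cong ; additive = Δ-additive ; homogeneous = Δ-homogeneous }

  Δ-coassoc-contract : ∀ (F : Vec H 3 → H) → IsMultilinearᴹ F → ∀ z →
    contract R M (λ u z₂ → contract R M (λ z₁₁ z₁₂ → F (z₁₁ ∷ z₁₂ ∷ z₂ ∷ [])) (Δ u)) (Δ z) ≈ᴹ
    contract R M (λ z₁ u → contract R M (λ z₂₁ z₂₂ → F (z₁ ∷ z₂₁ ∷ z₂₂ ∷ [])) (Δ u)) (Δ z)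
  Δ-coassoc-contract F F-lin z = begin
    contract R M (λ u z₂ → contract R M (λ z₁₁ z₁₂ → F (z₁₁ ∷ z₁₂ ∷ z₂ ∷ [])) (Δ u)) (Δ z)
      ≈⟨ ≈ᴹ-sym (extendᴹ-liftFirst Δ F (Δ z)) ⟩
    extendᴹ F (liftFirst R M Δ (Δ z))
      ≈⟨ extendᴹ-cong F-lin (Δ-coassoc z) ⟩
    extendᴹ F (liftSecond R M Δ (Δ z))
      ≈⟨ extendᴹ-liftSecond Δ F (Δ z) ⟩
    contract R M (λ z₁ u → contract R M (λ z₂₁ z₂₂ → F (z₁ ∷ z₂₁ ∷ z₂₂ ∷ [])) (Δ u)) (Δ z) ∎
    where open SetoidReasoning ≈ᴹ-setoid

  -- The one place where the invertibility of γ is used.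
  1H-▷ : ∀ z → 1H ▷ z ≈ᴹ ε z *ₗ 1H
  1H-▷ z = ≈ᴹ-sym (begin
    ε z *ₗ 1H
      ≈⟨ ≈ᴹ-sym (γ⋆β z 1H) ⟩
    contract R M (λ z₁ z₂ → β z₂ 1H ▷ z₁) (Δ z)
      ≈⟨ contract-cong (λ z₁ z₂ → ≈ᴹ-trans (Linear.cong (▷-linearˡ z₁) (≈ᴹ-sym (·-identityˡ (β z₂ 1H))))
                                           (·-▷ 1H (β z₂ 1H) z₁)) (Δ z) ⟩
    contract R M (λ u z₂ → contract R M (λ z₁₁ z₁₂ → F (z₁₁ ∷ z₁₂ ∷ z₂ ∷ [])) (Δ u)) (Δ z)
      ≈⟨ Δ-coassoc-contract F F-multilinear z ⟩
    contract R M (λ z₁ u → contract R M (λ z₂₁ z₂₂ → F (z₁ ∷ z₂₁ ∷ z₂₂ ∷ [])) (Δ u)) (Δ z)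
      ≈⟨ contract-cong γ⋆β-inner (Δ z) ⟩
    contract R M (λ z₁ z₂ → ε z₂ *ₗ (1H ▷ z₁)) (Δ z)
      ≈⟨ contract-linear _ (λ z₁ z₂ → ε z₂ *ₗ z₁) (▷-linearʳ 1H)
           (λ z₁ z₂ → ≈ᴹ-sym (Linear.homogeneous (▷-linearʳ 1H) (ε z₂) z₁)) (Δ z) ⟩
    1H ▷ contract R M (λ z₁ z₂ → ε z₂ *ₗ z₁) (Δ z)
      ≈⟨ Linear.cong (▷-linearʳ 1H) (ε-counitʳ z) ⟩
    1H ▷ z ∎)
    where
      open SetoidReasoning ≈ᴹ-setoid

      F : Vec H 3 → H
      F (x ∷ y ∷ w ∷ []) = (1H ▷ x) · (β w 1H ▷ y)

      F-multilinear : IsMultilinearᴹ F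
      F-multilinear (x ∷ y ∷ w ∷ []) zero             = linear-∘ (·-linearˡ (β w 1H ▷ y)) (▷-linearʳ 1H)
      F-multilinear (x ∷ y ∷ w ∷ []) (suc zero)       = linear-∘ (·-linearʳ (1H ▷ x)) (▷-linearʳ (β w 1H))
      F-multilinear (x ∷ y ∷ w ∷ []) (suc (suc zero)) =
        linear-∘ (·-linearʳ (1H ▷ x)) (linear-∘ (▷-linearˡ y) (β-linearˡ 1H))

      γ⋆β-inner : ∀ z₁ u → contract R M (λ z₂₁ z₂₂ → F (z₁ ∷ z₂₁ ∷ z₂₂ ∷ [])) (Δ u) ≈ᴹ ε u *ₗ (1H ▷ z₁)
      γ⋆β-inner z₁ u = begin
        contract R M (λ z₂₁ z₂₂ → F (z₁ ∷ z₂₁ ∷ z₂₂ ∷ [])) (Δ u)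
          ≈⟨ contract-linear _ (λ z₂₁ z₂₂ → β z₂₂ 1H ▷ z₂₁) (·-linearʳ (1H ▷ z₁)) (λ _ _ → ≈ᴹ-refl) (Δ u) ⟩
        (1H ▷ z₁) · contract R M (λ z₂₁ z₂₂ → β z₂₂ 1H ▷ z₂₁) (Δ u)
          ≈⟨ Linear.cong (·-linearʳ (1H ▷ z₁)) (γ⋆β u 1H) ⟩
        (1H ▷ z₁) · (ε u *ₗ 1H)
          ≈⟨ Linear.homogeneous (·-linearʳ (1H ▷ z₁)) (ε u) 1H ⟩
        ε u *ₗ ((1H ▷ z₁) · 1H)
          ≈⟨ *ₗ-congˡ (·-identityʳ (1H ▷ z₁)) ⟩
        ε u *ₗ (1H ▷ z₁) ∎

  proj-linear : IsLinearEnd R M (proj R M P)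
  proj-linear = record
    { cong        = λ p → +ᴹ-cong p (-ᴹ‿cong (*ₗ-cong (ε-cong p) ≈ᴹ-refl))
    ; additive    = additive
    ; homogeneous = homogeneous
    }
    where
      open SetoidReasoning ≈ᴹ-setoid

      additive : ∀ x y → proj R M P (x +ᴹ y) ≈ᴹ proj R M P x +ᴹ proj R M P y
      additive x y = begin
        (x +ᴹ y) +ᴹ -ᴹ (ε (x +ᴹ y) *ₗ 1H)
          ≈⟨ +ᴹ-congˡ (-ᴹ‿cong (≈ᴹ-trans (*ₗ-cong (ε-additive x y) ≈ᴹ-refl) (*ₗ-distribʳ 1H (ε x) (ε y)))) ⟩
        (x +ᴹ y) +ᴹ -ᴹ ((ε x *ₗ 1H) +ᴹ (ε y *ₗ 1H))
          ≈⟨ +ᴹ-congˡ (≈ᴹ-sym (⁻¹-∙-comm _ _)) ⟩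
        (x +ᴹ y) +ᴹ (-ᴹ (ε x *ₗ 1H) +ᴹ -ᴹ (ε y *ₗ 1H))
          ≈⟨ +ᴹ-interchange x y _ _ ⟩
        proj R M P x +ᴹ proj R M P y ∎

      homogeneous : ∀ b x → proj R M P (b *ₗ x) ≈ᴹ b *ₗ proj R M P x
      homogeneous b x = begin
        (b *ₗ x) +ᴹ -ᴹ (ε (b *ₗ x) *ₗ 1H)
          ≈⟨ +ᴹ-congˡ (-ᴹ‿cong (≈ᴹ-trans (*ₗ-cong (ε-homogeneous b x) ≈ᴹ-refl) (*ₗ-assoc b (ε x) 1H))) ⟩
        (b *ₗ x) +ᴹ -ᴹ (b *ₗ (ε x *ₗ 1H))
          ≈⟨ +ᴹ-congˡ (≈ᴹ-sym (linear-neg (*ₗ-linear b) _)) ⟩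
        (b *ₗ x) +ᴹ b *ₗ -ᴹ (ε x *ₗ 1H)
          ≈⟨ ≈ᴹ-sym (*ₗ-distribˡ b _ _) ⟩
        b *ₗ proj R M P x ∎

  -- ε (x ▷ y) = ε x ε y and 1 ▷ y = ε y 1 make the counit correction commute with ▷.
  proj-▷ : ∀ x y → proj R M P (x ▷ y) ≈ᴹ proj R M P x ▷ y
  proj-▷ x y = ≈ᴹ-sym (begin
    (x +ᴹ -ᴹ (ε x *ₗ 1H)) ▷ y              ≈⟨ Linear.additive (▷-linearˡ y) x _ ⟩
    (x ▷ y) +ᴹ (-ᴹ (ε x *ₗ 1H) ▷ y)        ≈⟨ +ᴹ-congˡ (linear-neg (▷-linearˡ y) _) ⟩
    (x ▷ y) +ᴹ -ᴹ ((ε x *ₗ 1H) ▷ y)        ≈⟨ +ᴹ-congˡ (-ᴹ‿cong (Linear.homogeneous (▷-linearˡ y) (ε x) 1H)) ⟩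
    (x ▷ y) +ᴹ -ᴹ (ε x *ₗ (1H ▷ y))        ≈⟨ +ᴹ-congˡ (-ᴹ‿cong (*ₗ-congˡ (1H-▷ y))) ⟩
    (x ▷ y) +ᴹ -ᴹ (ε x *ₗ (ε y *ₗ 1H))     ≈⟨ +ᴹ-congˡ (-ᴹ‿cong (≈ᴹ-sym (*ₗ-assoc _ _ _))) ⟩
    (x ▷ y) +ᴹ -ᴹ ((ε x *ₖ ε y) *ₗ 1H)     ≈⟨ +ᴹ-congˡ (-ᴹ‿cong (*ₗ-cong (sym (▷-ε x y)) ≈ᴹ-refl)) ⟩
    proj R M P (x ▷ y)                      ∎)
    where open SetoidReasoning ≈ᴹ-setoid

  -- Δ̃ x is definitionally Δ x′ ++ unitTerms x′ with x′ = proj x.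
  unitTerms : H → H^⊗ 2
  unitTerms p = (-ₖ 1# , 1H ∷ p ∷ []) ∷ (-ₖ 1# , p ∷ 1H ∷ []) ∷ []

  unitTerms-linear : IsLinear⊗ unitTerms
  unitTerms-linear = record
    { cong        = λ p → ∷-cong (slot-cong {v = 1H ∷ 1H ∷ []} (suc zero) p)
                                 (∷-cong (slot-cong {v = 1H ∷ 1H ∷ []} zero p) ≈T-refl)
    ; additive    = λ x y →
        ≈T-trans (≈T-++ {s = _ ∷ []} {s′ = _ ∷ _ ∷ []} (slot-+ {v = 1H ∷ 1H ∷ []} (suc zero))
                                                        (slot-+ {v = 1H ∷ 1H ∷ []} zero))
                 (++-interchange ((-ₖ 1# , 1H ∷ x ∷ []) ∷ []) ((-ₖ 1# , 1H ∷ y ∷ []) ∷ [])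
                                 ((-ₖ 1# , x ∷ 1H ∷ []) ∷ []) ((-ₖ 1# , y ∷ 1H ∷ []) ∷ []))
    ; homogeneous = λ b x →
        ∷-cong (≈T-trans (slot-* {v = 1H ∷ 1H ∷ []} (suc zero)) (coeff-cong (*-comm _ _)))
               (∷-cong (≈T-trans (slot-* {v = 1H ∷ 1H ∷ []} zero) (coeff-cong (*-comm _ _))) ≈T-refl)
    }

  Δ̃-linear : IsLinear⊗ (Δ̃ R M P)
  Δ̃-linear = IsLinear⊗-++ (IsLinear⊗-∘ Δ-linear proj-linear) (IsLinear⊗-∘ unitTerms-linear proj-linear)

  pairwise-1⊗ : ∀ a p y rest → pairwise R M _▷_ ((a , 1H ∷ p ∷ []) ∷ rest) (Δ y) ≋
                                 ((a , 1H ∷ p ▷ y ∷ []) ∷ pairwise R M _▷_ rest (Δ y))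
  pairwise-1⊗ a p y rest = ++-congˡ {s′ = _ ∷ []} (begin
    map _ (Δ y)
      ≈⟨ map-cong-≋ (λ { (d , y₁ ∷ y₂ ∷ []) → begin
           (a *ₖ d , 1H ▷ y₁ ∷ p ▷ y₂ ∷ []) ∷ []           ≈⟨ slot-cong {v = 1H ∷ p ▷ y₂ ∷ []} zero (1H-▷ y₁) ⟩
           (a *ₖ d , ε y₁ *ₗ 1H ∷ p ▷ y₂ ∷ []) ∷ []        ≈⟨ slot-* {v = 1H ∷ p ▷ y₂ ∷ []} zero ⟩
           ((a *ₖ d) *ₖ ε y₁ , 1H ∷ p ▷ y₂ ∷ []) ∷ []      ≈⟨ ≈T-sym (slot-* {v = 1H ∷ 1H ∷ []} (suc zero)) ⟩
           (a *ₖ d , 1H ∷ ε y₁ *ₗ (p ▷ y₂) ∷ []) ∷ []      ∎ }) (Δ y) ⟩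
    map (intoSlot a (1H ∷ 1H ∷ []) (suc zero) (λ y₁ y₂ → ε y₁ *ₗ (p ▷ y₂))) (Δ y)
      ≈⟨ map-intoSlot a (1H ∷ 1H ∷ []) (suc zero) _ (Δ y) ⟩
    (a , 1H ∷ contract R M (λ y₁ y₂ → ε y₁ *ₗ (p ▷ y₂)) (Δ y) ∷ []) ∷ []
      ≈⟨ slot-cong {v = 1H ∷ 1H ∷ []} (suc zero) (≈ᴹ-trans
           (contract-linear _ (λ y₁ y₂ → ε y₁ *ₗ y₂) (▷-linearʳ p)
              (λ y₁ y₂ → ≈ᴹ-sym (Linear.homogeneous (▷-linearʳ p) (ε y₁) y₂)) (Δ y))
           (Linear.cong (▷-linearʳ p) (ε-counitˡ y))) ⟩
    (a , 1H ∷ p ▷ y ∷ []) ∷ [] ∎)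
    where open ≋-Reasoning

  pairwise-⊗1 : ∀ a p y rest → pairwise R M _▷_ ((a , p ∷ 1H ∷ []) ∷ rest) (Δ y) ≋
                                 ((a , p ▷ y ∷ 1H ∷ []) ∷ pairwise R M _▷_ rest (Δ y))
  pairwise-⊗1 a p y rest = ++-congˡ {s′ = _ ∷ []} (begin
    map _ (Δ y)
      ≈⟨ map-cong-≋ (λ { (d , y₁ ∷ y₂ ∷ []) → begin
           (a *ₖ d , p ▷ y₁ ∷ 1H ▷ y₂ ∷ []) ∷ []           ≈⟨ slot-cong {v = p ▷ y₁ ∷ 1H ∷ []} (suc zero) (1H-▷ y₂) ⟩
           (a *ₖ d , p ▷ y₁ ∷ ε y₂ *ₗ 1H ∷ []) ∷ []        ≈⟨ slot-* {v = p ▷ y₁ ∷ 1H ∷ []} (suc zero) ⟩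
           ((a *ₖ d) *ₖ ε y₂ , p ▷ y₁ ∷ 1H ∷ []) ∷ []      ≈⟨ ≈T-sym (slot-* {v = 1H ∷ 1H ∷ []} zero) ⟩
           (a *ₖ d , ε y₂ *ₗ (p ▷ y₁) ∷ 1H ∷ []) ∷ []      ∎ }) (Δ y) ⟩
    map (intoSlot a (1H ∷ 1H ∷ []) zero (λ y₁ y₂ → ε y₂ *ₗ (p ▷ y₁))) (Δ y)
      ≈⟨ map-intoSlot a (1H ∷ 1H ∷ []) zero _ (Δ y) ⟩
    (a , contract R M (λ y₁ y₂ → ε y₂ *ₗ (p ▷ y₁)) (Δ y) ∷ 1H ∷ []) ∷ []
      ≈⟨ slot-cong {v = 1H ∷ 1H ∷ []} zero (≈ᴹ-trans
           (contract-linear _ (λ y₁ y₂ → ε y₂ *ₗ y₁) (▷-linearʳ p)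
              (λ y₁ y₂ → ≈ᴹ-sym (Linear.homogeneous (▷-linearʳ p) (ε y₂) y₁)) (Δ y))
           (Linear.cong (▷-linearʳ p) (ε-counitʳ y))) ⟩
    (a , p ▷ y ∷ 1H ∷ []) ∷ [] ∎)
    where open ≋-Reasoning

  unitTerms-▷ : ∀ p y → unitTerms (p ▷ y) ≋ pairwise R M _▷_ (unitTerms p) (Δ y)
  unitTerms-▷ p y = ≈T-sym (≈T-trans (pairwise-1⊗ (-ₖ 1#) p y ((-ₖ 1# , p ∷ 1H ∷ []) ∷ []))
                                     (∷-cong ≈T-refl (pairwise-⊗1 (-ₖ 1#) p y [])))

  Δ̃-▷ : ∀ x y → Δ̃ R M P (x ▷ y) ≋ pairwise R M _▷_ (Δ̃ R M P x) (Δ y)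
  Δ̃-▷ x y = begin
    Δ̃ R M P (x ▷ y)
      ≈⟨ IsLinear⊗.cong (IsLinear⊗-++ Δ-linear unitTerms-linear) (proj-▷ x y) ⟩
    Δ (p ▷ y) ++ unitTerms (p ▷ y)
      ≈⟨ ≈T-++ (▷-Δ p y) (unitTerms-▷ p y) ⟩
    pairwise R M _▷_ (Δ p) (Δ y) ++ pairwise R M _▷_ (unitTerms p) (Δ y)
      ≡⟨ ≡.sym (cartesianProductWith-distribʳ-++ _ (Δ p) (unitTerms p) (Δ y)) ⟩
    pairwise R M _▷_ (Δ̃ R M P x) (Δ y) ∎
    where
      open ≋-Reasoning

      p : H
      p = proj R M P x

  ▷-slots : ∀ {n} → Vec H n → K × Vec H n → K × Vec H n
  ▷-slots v (b , w) = (b , zipWith _▷_ v w)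

  infixl 6 _▷⊗_
  _▷⊗_ : ∀ {n} → H^⊗ n → H^⊗ n → H^⊗ n
  t ▷⊗ s = extend (λ v → map (▷-slots v) s) t

  ▷-slots-multilinear : ∀ {n} (s : H^⊗ n) → IsMultilinear⊗ (λ v → map (▷-slots v) s)
  ▷-slots-multilinear s v i = record
    { cong        = λ p → map-cong-≋ (cong-slot p) s
    ; additive    = λ x y → map-split-≋ (additive-slot x y) s
    ; homogeneous = λ b x → map-∘-cong-≋ (homogeneous-slot b x) s
    }
    where
      cong-slot : ∀ {x y} → x ≈ᴹ y → ∀ e → (▷-slots (v [ i ]≔ x) e ∷ []) ≋ (▷-slots (v [ i ]≔ y) e ∷ [])
      cong-slot {x} {y} p (b , w) rewrite zipWith-[]≔ _▷_ v w i x | zipWith-[]≔ _▷_ v w i y =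
        slot-cong i (Linear.cong (▷-linearˡ (lookup w i)) p)

      additive-slot : ∀ x y e →
        (▷-slots (v [ i ]≔ (x +ᴹ y)) e ∷ []) ≋ (▷-slots (v [ i ]≔ x) e ∷ ▷-slots (v [ i ]≔ y) e ∷ [])
      additive-slot x y (b , w)
        rewrite zipWith-[]≔ _▷_ v w i (x +ᴹ y) | zipWith-[]≔ _▷_ v w i x | zipWith-[]≔ _▷_ v w i y =
        ≈T-trans (slot-cong i (Linear.additive (▷-linearˡ (lookup w i)) x y)) (slot-+ i)

      homogeneous-slot : ∀ b x e → (▷-slots (v [ i ]≔ (b *ₗ x)) e ∷ []) ≋
                                   scaleT R M b (▷-slots (v [ i ]≔ x) e ∷ [])
      homogeneous-slot b x (d , w) rewrite zipWith-[]≔ _▷_ v w i (b *ₗ x) | zipWith-[]≔ _▷_ v w i x =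
        ≈T-trans (slot-cong i (Linear.homogeneous (▷-linearˡ (lookup w i)) b x))
                 (≈T-trans (slot-* i) (coeff-cong (*-comm _ _)))

  ▷⊗-congˡ : ∀ {n} (s : H^⊗ n) {t t′} → t ≋ t′ → t ▷⊗ s ≋ t′ ▷⊗ s
  ▷⊗-congˡ s = extend-cong (▷-slots-multilinear s)

  ▷⊗-zeroʳ : ∀ {n} (t : H^⊗ n) → t ▷⊗ [] ≡ []
  ▷⊗-zeroʳ []            = ≡.refl
  ▷⊗-zeroʳ ((a , v) ∷ t) = ▷⊗-zeroʳ t

  ▷⊗-distribˡ-++ : ∀ {n} (t s₁ s₂ : H^⊗ n) → t ▷⊗ (s₁ ++ s₂) ≋ t ▷⊗ s₁ ++ t ▷⊗ s₂
  ▷⊗-distribˡ-++ []            s₁ s₂ = ≈T-refl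
  ▷⊗-distribˡ-++ ((a , v) ∷ t) s₁ s₂ = begin
    row (s₁ ++ s₂) ++ t ▷⊗ (s₁ ++ s₂)
      ≡⟨ ≡.cong (_++ t ▷⊗ (s₁ ++ s₂))
                (≡.trans (≡.cong (scaleT R M a) (map-++ (▷-slots v) s₁ s₂))
                         (map-++ _ (map (▷-slots v) s₁) _)) ⟩
    (row s₁ ++ row s₂) ++ t ▷⊗ (s₁ ++ s₂)
      ≈⟨ ++-congʳ {s = row s₁ ++ row s₂} (▷⊗-distribˡ-++ t s₁ s₂) ⟩
    (row s₁ ++ row s₂) ++ (t ▷⊗ s₁ ++ t ▷⊗ s₂)
      ≈⟨ ++-interchange (row s₁) (row s₂) (t ▷⊗ s₁) (t ▷⊗ s₂) ⟩
    (row s₁ ++ t ▷⊗ s₁) ++ (row s₂ ++ t ▷⊗ s₂) ∎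
    where
      open ≋-Reasoning

      row : H^⊗ _ → H^⊗ _
      row s = scaleT R M a (map (▷-slots v) s)

  module _ {n} (a b : K) (v w : Vec H n) where

    pairwise-row-▷⊗ : ∀ d p₁ p₂ Q →
      map (append (a *ₖ b) (zipWith _▷_ v w)) (pairwise R M _▷_ ((d , p₁ ∷ p₂ ∷ []) ∷ []) Q) ≋
      scaleT R M (a *ₖ d) (map (▷-slots (p₁ ∷ p₂ ∷ v)) (map (append b w) Q))
    pairwise-row-▷⊗ d p₁ p₂ []                         = ≈T-refl
    pairwise-row-▷⊗ d p₁ p₂ ((d′ , q₁ ∷ q₂ ∷ []) ∷ Q) =
      ∷-cong (coeff-cong (interchange a b d d′)) (pairwise-row-▷⊗ d p₁ p₂ Q)

    append-pairwise-▷⊗ : ∀ P Q → map (append (a *ₖ b) (zipWith _▷_ v w)) (pairwise R M _▷_ P Q) ≋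
                                 map (append a v) P ▷⊗ map (append b w) Q
    append-pairwise-▷⊗ []                          Q = ≈T-refl
    append-pairwise-▷⊗ ((d , p₁ ∷ p₂ ∷ []) ∷ P) Q = begin
      map app (pairwise R M _▷_ ((d , p₁ ∷ p₂ ∷ []) ∷ P) Q)
        ≡⟨ ≡.cong (λ X → map app (X ++ pairwise R M _▷_ P Q)) (≡.sym (++-identityʳ _)) ⟩
      map app (pairwise R M _▷_ ((d , p₁ ∷ p₂ ∷ []) ∷ []) Q ++ pairwise R M _▷_ P Q)
        ≡⟨ map-++ app (pairwise R M _▷_ ((d , p₁ ∷ p₂ ∷ []) ∷ []) Q) _ ⟩
      map app (pairwise R M _▷_ ((d , p₁ ∷ p₂ ∷ []) ∷ []) Q) ++ map app (pairwise R M _▷_ P Q)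
        ≈⟨ ≈T-++ (pairwise-row-▷⊗ d p₁ p₂ Q) (append-pairwise-▷⊗ P Q) ⟩
      map (append a v) ((d , p₁ ∷ p₂ ∷ []) ∷ P) ▷⊗ map (append b w) Q ∎
      where
        open ≋-Reasoning

        app : K × Vec H 2 → K × Vec H (2 + n)
        app = append (a *ₖ b) (zipWith _▷_ v w)

  liftFirst-▷⊗-row : ∀ {n} a x (v : Vec H n) s →
    liftFirst R M (Δ̃ R M P) (scaleT R M a (map (▷-slots (x ∷ v)) s)) ≋
    map (append a v) (Δ̃ R M P x) ▷⊗ liftFirst R M Δ s
  liftFirst-▷⊗-row a x v []                 = ≡⇒≋ (≡.sym (▷⊗-zeroʳ (map (append a v) (Δ̃ R M P x))))
  liftFirst-▷⊗-row a x v ((b , y ∷ w) ∷ s) = begin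
    liftFirst R M (Δ̃ R M P) ((a *ₖ b , x ▷ y ∷ zipWith _▷_ v w) ∷ scaleT R M a (map (▷-slots (x ∷ v)) s))
      ≡⟨ liftFirst-∷ (Δ̃ R M P) (a *ₖ b) (x ▷ y) (zipWith _▷_ v w) (scaleT R M a (map (▷-slots (x ∷ v)) s)) ⟩
    map (append (a *ₖ b) (zipWith _▷_ v w)) (Δ̃ R M P (x ▷ y)) ++
      liftFirst R M (Δ̃ R M P) (scaleT R M a (map (▷-slots (x ∷ v)) s))
      ≈⟨ ≈T-++ (≈T-trans (map-append-cong _ _ (Δ̃-▷ x y)) (append-pairwise-▷⊗ a b v w (Δ̃ R M P x) (Δ y)))
               (liftFirst-▷⊗-row a x v s) ⟩
    X ▷⊗ map (append b w) (Δ y) ++ X ▷⊗ liftFirst R M Δ s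
      ≈⟨ ≈T-sym (▷⊗-distribˡ-++ X (map (append b w) (Δ y)) (liftFirst R M Δ s)) ⟩
    X ▷⊗ (map (append b w) (Δ y) ++ liftFirst R M Δ s)
      ≡⟨ ≡.cong (X ▷⊗_) (≡.sym (liftFirst-∷ Δ b y w s)) ⟩
    X ▷⊗ liftFirst R M Δ ((b , y ∷ w) ∷ s) ∎
    where
      open ≋-Reasoning

      X : H^⊗ _
      X = map (append a v) (Δ̃ R M P x)

  liftFirst-▷⊗ : ∀ {n} (t s : H^⊗ (suc n)) →
    liftFirst R M (Δ̃ R M P) (t ▷⊗ s) ≋ liftFirst R M (Δ̃ R M P) t ▷⊗ liftFirst R M Δ s
  liftFirst-▷⊗ []                 s = ≈T-refl
  liftFirst-▷⊗ ((a , x ∷ v) ∷ t) s = begin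
    liftFirst R M (Δ̃ R M P) (scaleT R M a (map (▷-slots (x ∷ v)) s) ++ t ▷⊗ s)
      ≡⟨ liftFirst-++ (Δ̃ R M P) (scaleT R M a (map (▷-slots (x ∷ v)) s)) (t ▷⊗ s) ⟩
    liftFirst R M (Δ̃ R M P) (scaleT R M a (map (▷-slots (x ∷ v)) s)) ++ liftFirst R M (Δ̃ R M P) (t ▷⊗ s)
      ≈⟨ ≈T-++ (liftFirst-▷⊗-row a x v s) (liftFirst-▷⊗ t s) ⟩
    map (append a v) (Δ̃ R M P x) ▷⊗ liftFirst R M Δ s ++ liftFirst R M (Δ̃ R M P) t ▷⊗ liftFirst R M Δ s
      ≡⟨ ≡.sym (extend-++ _ (map (append a v) (Δ̃ R M P x)) (liftFirst R M (Δ̃ R M P) t)) ⟩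
    (map (append a v) (Δ̃ R M P x) ++ liftFirst R M (Δ̃ R M P) t) ▷⊗ liftFirst R M Δ s
      ≡⟨ ≡.cong (_▷⊗ liftFirst R M Δ s) (≡.sym (liftFirst-∷ (Δ̃ R M P) a x v t)) ⟩
    liftFirst R M (Δ̃ R M P) ((a , x ∷ v) ∷ t) ▷⊗ liftFirst R M Δ s ∎
    where open ≋-Reasoning

  Δ^ : (k : ℕ) → H → H^⊗ (suc k)
  Δ^ zero    y = (1# , y ∷ []) ∷ []
  Δ^ (suc k) y = liftFirst R M Δ (Δ^ k y)

  Δ̃^-▷ : ∀ k x y → Δ̃^ R M P k (x ▷ y) ≋ Δ̃^ R M P k x ▷⊗ Δ^ k y
  Δ̃^-▷ zero    x y =
    ≈T-trans (slot-cong {v = 1H ∷ []} zero (proj-▷ x y)) (coeff-cong (sym (*-identityˡ 1#)))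
  Δ̃^-▷ (suc k) x y =
    ≈T-trans (liftFirst-cong Δ̃-linear (Δ̃^-▷ k x y)) (liftFirst-▷⊗ (Δ̃^ R M P k x) (Δ^ k y))

  Filt-▷ : ∀ n x y → Filt R M P n x → Filt R M P n (x ▷ y)
  Filt-▷ n x y Δ̃ⁿx≈0 = ≈T-trans (Δ̃^-▷ n x y) (▷⊗-congˡ (Δ^ n y) Δ̃ⁿx≈0)

mainTheorem8 : ∀ {c ℓ m ℓm} (R : CommutativeRing c ℓ) → IsField R →
    (M : Module R m ℓm) (P : RightPostHopf R M) → Connected R M P →
    ∀ (n : ℕ) x y → Filt R M P n x → Filt R M P n (RightPostHopf._▷_ P x y)
mainTheorem8 R _ M P _ = PostHopf.Filt-▷ P
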